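{- For every natural number $k$ and every formula $\varphi$: (1) $\varphi \in \mathrm{E}_k^+$ if and only if $\mathrm{PNF}(\varphi) \cap \Sigma_k^+ \neq \emptyset$. (2) $\varphi \in \mathrm{U}_k^+$ if and only if $\mathrm{PNF}(\varphi) \cap \Pi_k^+ \neq \emptyset$. (3) $\varphi \in \mathrm{F}_k^+$ if and only if $\mathrm{PNF}(\varphi) \cap \Sigma_{k+1}^+ \neq \emptyset$ and $\mathrm{PNF}(\varphi) \cap \Pi_{k+1}^+ \neq \emptyset$. (4) $\varphi \in \mathrm{E}_{k+1}$ if and only if $\mathrm{PNF}(\varphi) \cap \Sigma_{k+1}^+ \neq \emptyset$ and $\mathrm{PNF}(\varphi) \cap \Pi_{k+1}^+ = \emptyset$; equivalently, if and only if $\mathrm{PNF}(\varphi) \cap \Sigma_{k+1} \neq \emptyset$ and $\mathrm{PNF}(\varphi) \cap \Pi_{k+1}^+ = \emptyset$. (5) $\varphi \in \mathrm{U}_{k+1}$ if and only if $\mathrm{PNF}(\varphi) \cap \Pi_{k+1}^+ \neq \emptyset$ and $\mathrm{PNF}(\varphi) \cap \Sigma_{k+1}^+ = \emptyset$; equivalently, if and only if $\mathrm{PNF}(\varphi) \cap \Pi_{k+1} \neq \emptyset$ and $\mathrm{PNF}(\varphi) \cap \Sigma_{k+1}^+ = \emptyset$. (6) $\varphi \in \mathrm{PF}_k$ if and only if $\mathrm{PNF}(\varphi) \cap \Sigma_{k+1}^+ \neq \emptyset$, $\mathrm{PNF}(\varphi) \cap \Pi_{k+1}^+ \neq \emptyset$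 and $\mathrm{PNF}(\varphi) \cap (\Sigma_k^+ \cup \Pi_k^+) = \emptyset$; equivalently, if and only if $\mathrm{PNF}(\varphi) \cap \Sigma_{k+1} \neq \emptyset$, $\mathrm{PNF}(\varphi) \cap \Pi_{k+1} \neq \emptyset$ and $\mathrm{PNF}(\varphi) \cap (\Sigma_k^+ \cup \Pi_k^+) = \emptyset$.
   Context: Fix an arbitrary first-order language whose logical symbols are $\forall, \exists, \to, \land, \lor, \perp$ ($\neg\varphi$ abbreviates $\varphi \to \perp$). All formulas are formulas of this language; $\mathrm{FV}(\varphi)$ is the set of free variables of $\varphi$. Prenex classes: $\Sigma_0 = \Pi_0$ is the class of quantifier-free formulas; $\Sigma_{k+1}$ is the class of formulas $\exists x_1 \cdots \exists x_n \varphi$ with $n \geq 1$ and $\varphi \in \Pi_k$; $\Pi_{k+1}$ is the class of formulas $\forall x_1 \cdots \forall x_n \varphi$ with $n\ge 1$ and $\varphi \in \Sigma_k$. Cumulative versions: $\Sigma_k^+ = \Sigma_k \cup \bigcup_{i<k}(\Sigma_i \cup \Pi_i)$ and $\Pi_k^+ = \Pi_k \cup \bigcup_{i<k}(\Sigma_i \cup \Pi_i)$. A formula is in prenex normal form if it is in $\Sigma_k \cup \Pi_k$ for some $k$. Alternation paths: an alternation path is a finite sequence of the symbols $+$ and $-$ in which $+$ and $-$ alternate. For an alternation path $s$, $i(s)$ is the first symbol of $s$ if $s$ is nonempty and a special symbol $\times$ if $s = \langle\,\rangle$; $s^\perp$ is obtained by swapping $+$ and $-$ in $s$; $l(s)$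 is the length of $s$; $+s$, $-s$ denote prepending a symbol. The set $\mathrm{Alt}(\varphi)$: if $\varphi$ is quantifier-free, $\mathrm{Alt}(\varphi) = \{\langle\,\rangle\}$; otherwise inductively $\mathrm{Alt}(\varphi_1 \land \varphi_2) = \mathrm{Alt}(\varphi_1\lor\varphi_2) = \mathrm{Alt}(\varphi_1) \cup \mathrm{Alt}(\varphi_2)$; $\mathrm{Alt}(\varphi_1 \to \varphi_2) = \{s^\perp : s \in \mathrm{Alt}(\varphi_1)\} \cup \mathrm{Alt}(\varphi_2)$; $\mathrm{Alt}(\forall x \varphi_1) = \{s \in \mathrm{Alt}(\varphi_1) : i(s) = -\} \cup \{ -s : s \in \mathrm{Alt}(\varphi_1),\ i(s) \neq -\}$; $\mathrm{Alt}(\exists x \varphi_1) = \{s \in \mathrm{Alt}(\varphi_1) : i(s) = +\} \cup \{+s : s \in \mathrm{Alt}(\varphi_1),\ i(s) \neq +\}$. The degree is $\deg(\varphi) = \max\{l(s) : s \in \mathrm{Alt}(\varphi)\}$. Classes: $\mathrm{F}_k = \{\varphi : \deg(\varphi) = k\}$; $\mathrm{F}_k^+ = \{\varphi : \deg(\varphi) \le k\}$; $\mathrm{U}_0 = \mathrm{E}_0 = \mathrm{F}_0$; $\mathrm{U}_{k+1} = \{\varphi \in \mathrm{F}_{k+1} : i(s) = - \text{ for all } s \in \mathrm{Alt}(\varphi) \text{ with } l(s) = k+1\}$; $\mathrm{E}_{k+1} = \{\varphi \in \mathrm{F}_{k+1} : i(s) = + \text{ for all } s \in \mathrm{Alt}(\varphi)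 \text{ with } l(s) = k+1\}$; $\mathrm{PF}_k = \mathrm{F}_k \setminus (\mathrm{E}_k \cup \mathrm{U}_k)$ (so $\mathrm{PF}_0 = \emptyset$); $\mathrm{U}_k^+ = \mathrm{U}_k \cup \bigcup_{i<k}\mathrm{F}_i$; $\mathrm{E}_k^+ = \mathrm{E}_k \cup \bigcup_{i<k}\mathrm{F}_i$. Prenex transformation: $\varphi \rhd \psi$ means that for some formulas $\xi,\delta$, a variable $x \notin \mathrm{FV}(\delta)$, a variable $y$ not occurring in $\xi$, and $Q \in \{\forall,\exists\}$, the pair $(\varphi,\psi)$ is one of: $(\exists x\xi(x) \to \delta,\ \forall x(\xi(x)\to\delta))$; $(\forall x\xi(x)\to\delta,\ \exists x(\xi(x)\to\delta))$; $(\delta \to Qx\,\xi(x),\ Qx(\delta\to\xi(x)))$; $(Qx\,\xi(x)\land\delta,\ Qx(\xi(x)\land\delta))$; $(\delta\land Qx\,\xi(x),\ Qx(\delta\land\xi(x)))$; $(Qx\,\xi(x)\lor\delta,\ Qx(\xi(x)\lor\delta))$; $(\delta\lor Qx\,\xi(x),\ Qx(\delta\lor\xi(x)))$; $(Qx\,\xi(x),\ Qy\,\xi(y))$, where $\xi(y)$ is $\xi(x)$ with $y$ substituted for the free occurrences of $x$. $\varphi \rhd^* \psi$ means there are $m \ge 0$ and formulas $\varphi_0 \equiv \varphi, \varphi_1, \dots, \varphi_m \equiv \psi$ such that for each $i<m$, $\varphi_{i+1}$ is obtained from $\varphi_i$ by replacing one occurrence of a subformula $\xi_i$ by a formula $\delta_i$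 with $\xi_i \rhd \delta_i$. Finally $\mathrm{PNF}(\varphi) = \{\psi : \varphi \rhd^* \psi \text{ and } \psi \text{ is in prenex normal form}\}$. -}

module Defs where

open import Data.Nat using (ℕ; zero; suc; _≤_; _<_; _⊔_; _≟_)
open import Data.Vec using (Vec; []; _∷_)
open import Data.List using (List; []; _∷_; _++_; map; foldr; length)
open import Data.List.Membership.Propositional using (_∈_)
open import Data.Maybe using (Maybe; just; nothing)
open import Data.Product using (Σ; _×_; ∃; Σ-syntax; ∃-syntax)
open import Data.Sum using (_⊎_)
open import Data.Empty using (⊥)
open import Data.Unit using (⊤)
open import Relation.Nullary using (¬_; yes; no)
open import Relation.Binary.PropositionalEquality using (_≡_)
open import Relation.Binary.Construct.Closure.ReflexiveTransitive using (Star)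

-- An arbitrary first-order signature (equality, if present, is one of
-- the relation symbols).  Variables are natural numbers.

record Signature : Set₁ where
  field
    FunSym  : Set
    funAr   : FunSym → ℕ
    RelSym  : Set
    relAr   : RelSym → ℕ
open Signature public

Var : Set
Var = ℕ

data Term (L : Signature) : Set where
  var : Var → Term L
  app : (f : FunSym L) → Vec (Term L) (funAr L f) → Term L

data Formula (L : Signature) : Set where
  rel  : (R : RelSym L) → Vec (Term L) (relAr L R) → Formula L
  bot  : Formula L
  _⇒_  : Formula L → Formula L → Formula L
  _∧_  : Formula L → Formula L → Formula L
  _∨_  : Formula L → Formula L → Formula L
  all  : Var → Formula L → Formula L
  ex   : Var → Formula L → Formula L

infixr 5 _⇒_
infixr 6 _∨_
infixr 7 _∧_

module _ {L : Signature} where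

  mutual
    data OccT (x : Var) : Term L → Set where
      here : OccT x (var x)
      inApp : ∀ {f ts} → OccTs x ts → OccT x (app f ts)

    data OccTs (x : Var) : ∀ {n} → Vec (Term L) n → Set where
      hd : ∀ {n t} {ts : Vec (Term L) n} → OccT x t → OccTs x (t ∷ ts)
      tl : ∀ {n t} {ts : Vec (Term L) n} → OccTs x ts → OccTs x (t ∷ ts)

  data Free (x : Var) : Formula L → Set where
    fRel : ∀ {R ts} → OccTs x ts → Free x (rel R ts)
    fImpL : ∀ {φ ψ} → Free x φ → Free x (φ ⇒ ψ)
    fImpR : ∀ {φ ψ} → Free x ψ → Free x (φ ⇒ ψ)
    fAndL : ∀ {φ ψ} → Free x φ → Free x (φ ∧ ψ)
    fAndR : ∀ {φ ψ} → Free x ψ → Free x (φ ∧ ψ)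
    fOrL  : ∀ {φ ψ} → Free x φ → Free x (φ ∨ ψ)
    fOrR  : ∀ {φ ψ} → Free x ψ → Free x (φ ∨ ψ)
    fAll  : ∀ {z φ} → ¬ (z ≡ x) → Free x φ → Free x (all z φ)
    fEx   : ∀ {z φ} → ¬ (z ≡ x) → Free x φ → Free x (ex z φ)

  data Occurs (x : Var) : Formula L → Set where
    oRel : ∀ {R ts} → OccTs x ts → Occurs x (rel R ts)
    oImpL : ∀ {φ ψ} → Occurs x φ → Occurs x (φ ⇒ ψ)
    oImpR : ∀ {φ ψ} → Occurs x ψ → Occurs x (φ ⇒ ψ)
    oAndL : ∀ {φ ψ} → Occurs x φ → Occurs x (φ ∧ ψ)
    oAndR : ∀ {φ ψ} → Occurs x ψ → Occurs x (φ ∧ ψ)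
    oOrL  : ∀ {φ ψ} → Occurs x φ → Occurs x (φ ∨ ψ)
    oOrR  : ∀ {φ ψ} → Occurs x ψ → Occurs x (φ ∨ ψ)
    oAllB : ∀ {φ} → Occurs x (all x φ)
    oAll  : ∀ {z φ} → Occurs x φ → Occurs x (all z φ)
    oExB  : ∀ {φ} → Occurs x (ex x φ)
    oEx   : ∀ {z φ} → Occurs x φ → Occurs x (ex z φ)

  mutual
    renT : Var → Var → Term L → Term L
    renT x y (var z) with z ≟ x
    ... | yes _ = var y
    ... | no  _ = var z
    renT x y (app f ts) = app f (renTs x y ts)

    renTs : ∀ {n} → Var → Var → Vec (Term L) n → Vec (Term L) n
    renTs x y [] = []
    renTs x y (t ∷ ts) = renT x y t ∷ renTs x y ts

  ren : Var → Var → Formula L → Formula L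
  ren x y (rel R ts) = rel R (renTs x y ts)
  ren x y bot = bot
  ren x y (φ ⇒ ψ) = ren x y φ ⇒ ren x y ψ
  ren x y (φ ∧ ψ) = ren x y φ ∧ ren x y ψ
  ren x y (φ ∨ ψ) = ren x y φ ∨ ren x y ψ
  ren x y (all z φ) with z ≟ x
  ... | yes _ = all z φ
  ... | no  _ = all z (ren x y φ)
  ren x y (ex z φ) with z ≟ x
  ... | yes _ = ex z φ
  ... | no  _ = ex z (ren x y φ)

  data Quant : Set where
    qAll qEx : Quant

  Q[_] : Quant → Var → Formula L → Formula L
  Q[ qAll ] = all
  Q[ qEx ]  = ex

  data _▷_ : Formula L → Formula L → Set where
    exImp  : ∀ {x ξ δ} → ¬ Free x δ → (ex x ξ ⇒ δ) ▷ all x (ξ ⇒ δ)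
    allImp : ∀ {x ξ δ} → ¬ Free x δ → (all x ξ ⇒ δ) ▷ ex x (ξ ⇒ δ)
    impQ   : ∀ {Q x ξ δ} → ¬ Free x δ → (δ ⇒ Q[ Q ] x ξ) ▷ Q[ Q ] x (δ ⇒ ξ)
    andQL  : ∀ {Q x ξ δ} → ¬ Free x δ → (Q[ Q ] x ξ ∧ δ) ▷ Q[ Q ] x (ξ ∧ δ)
    andQR  : ∀ {Q x ξ δ} → ¬ Free x δ → (δ ∧ Q[ Q ] x ξ) ▷ Q[ Q ] x (δ ∧ ξ)
    orQL   : ∀ {Q x ξ δ} → ¬ Free x δ → (Q[ Q ] x ξ ∨ δ) ▷ Q[ Q ] x (ξ ∨ δ)
    orQR   : ∀ {Q x ξ δ} → ¬ Free x δ → (δ ∨ Q[ Q ] x ξ) ▷ Q[ Q ] x (δ ∨ ξ)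
    rename : ∀ {Q x y ξ} → ¬ Occurs y ξ → (Q[ Q ] x ξ) ▷ Q[ Q ] y (ren x y ξ)

  data _⟶_ : Formula L → Formula L → Set where
    base  : ∀ {φ ψ} → φ ▷ ψ → φ ⟶ ψ
    impL  : ∀ {φ φ' ψ} → φ ⟶ φ' → (φ ⇒ ψ) ⟶ (φ' ⇒ ψ)
    impR  : ∀ {φ ψ ψ'} → ψ ⟶ ψ' → (φ ⇒ ψ) ⟶ (φ ⇒ ψ')
    andL  : ∀ {φ φ' ψ} → φ ⟶ φ' → (φ ∧ ψ) ⟶ (φ' ∧ ψ)
    andR  : ∀ {φ ψ ψ'} → ψ ⟶ ψ' → (φ ∧ ψ) ⟶ (φ ∧ ψ')
    orL   : ∀ {φ φ' ψ} → φ ⟶ φ' → (φ ∨ ψ) ⟶ (φ' ∨ ψ)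
    orR   : ∀ {φ ψ ψ'} → ψ ⟶ ψ' → (φ ∨ ψ) ⟶ (φ ∨ ψ')
    inAll : ∀ {z φ φ'} → φ ⟶ φ' → all z φ ⟶ all z φ'
    inEx  : ∀ {z φ φ'} → φ ⟶ φ' → ex z φ ⟶ ex z φ'

  _▷*_ : Formula L → Formula L → Set
  _▷*_ = Star _⟶_

  QF : Formula L → Set
  QF (rel R ts) = ⊤
  QF bot = ⊤
  QF (φ ⇒ ψ) = QF φ × QF ψ
  QF (φ ∧ ψ) = QF φ × QF ψ
  QF (φ ∨ ψ) = QF φ × QF ψ
  QF (all _ _) = ⊥
  QF (ex _ _) = ⊥

  exs : List Var → Formula L → Formula L
  exs [] φ = φ
  exs (x ∷ xs) φ = ex x (exs xs φ)

  alls : List Var → Formula L → Formula L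
  alls [] φ = φ
  alls (x ∷ xs) φ = all x (alls xs φ)

  mutual
    SigmaC : ℕ → Formula L → Set
    SigmaC zero φ = QF φ
    SigmaC (suc k) φ =
      Σ[ x ∈ Var ] Σ[ xs ∈ List Var ] Σ[ ψ ∈ Formula L ]
        (PiC k ψ × φ ≡ exs (x ∷ xs) ψ)

    PiC : ℕ → Formula L → Set
    PiC zero φ = QF φ
    PiC (suc k) φ =
      Σ[ x ∈ Var ] Σ[ xs ∈ List Var ] Σ[ ψ ∈ Formula L ]
        (SigmaC k ψ × φ ≡ alls (x ∷ xs) ψ)

  SigmaC⁺ : ℕ → Formula L → Set
  SigmaC⁺ k φ = SigmaC k φ ⊎ (∃[ i ] (i < k × (SigmaC i φ ⊎ PiC i φ)))

  PiC⁺ : ℕ → Formula L → Set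
  PiC⁺ k φ = PiC k φ ⊎ (∃[ i ] (i < k × (SigmaC i φ ⊎ PiC i φ)))

  Prenex : Formula L → Set
  Prenex φ = ∃[ k ] (SigmaC k φ ⊎ PiC k φ)

  PNFMeets : Formula L → (Formula L → Set) → Set
  PNFMeets φ C = ∃[ ψ ] (φ ▷* ψ × Prenex ψ × C ψ)

data Sign : Set where
  plus minus : Sign

Path : Set
Path = List Sign

-- i(s): nothing plays the role of ×
init : Path → Maybe Sign
init [] = nothing
init (a ∷ _) = just a

swap : Sign → Sign
swap plus = minus
swap minus = plus

_⊥ₚ : Path → Path
s ⊥ₚ = map swap s

addMinus : Path → Path
addMinus (minus ∷ s) = minus ∷ s
addMinus s = minus ∷ s

addPlus : Path → Path
addPlus (plus ∷ s) = plus ∷ s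
addPlus s = plus ∷ s

module _ {L : Signature} where

  -- Alt(φ) as a list (membership = set membership)
  Alt : Formula L → List Path
  Alt (rel R ts) = [] ∷ []
  Alt bot = [] ∷ []
  Alt (φ ⇒ ψ) = map _⊥ₚ (Alt φ) ++ Alt ψ
  Alt (φ ∧ ψ) = Alt φ ++ Alt ψ
  Alt (φ ∨ ψ) = Alt φ ++ Alt ψ
  Alt (all _ φ) = map addMinus (Alt φ)
  Alt (ex _ φ) = map addPlus (Alt φ)

  deg : Formula L → ℕ
  deg φ = foldr (λ s m → length s ⊔ m) 0 (Alt φ)

  F : ℕ → Formula L → Set
  F k φ = deg φ ≡ k

  F⁺ : ℕ → Formula L → Set
  F⁺ k φ = deg φ ≤ k

  U : ℕ → Formula L → Set
  U zero φ = F zero φ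
  U (suc k) φ = F (suc k) φ ×
    (∀ s → s ∈ Alt φ → length s ≡ suc k → init s ≡ just minus)

  E : ℕ → Formula L → Set
  E zero φ = F zero φ
  E (suc k) φ = F (suc k) φ ×
    (∀ s → s ∈ Alt φ → length s ≡ suc k → init s ≡ just plus)

  PF : ℕ → Formula L → Set
  PF k φ = F k φ × ¬ (E k φ ⊎ U k φ)

  U⁺ : ℕ → Formula L → Set
  U⁺ k φ = U k φ ⊎ (∃[ i ] (i < k × F i φ))

  E⁺ : ℕ → Formula L → Set
  E⁺ k φ = E k φ ⊎ (∃[ i ] (i < k × F i φ))

-- Write s ⊆ p for the subsequence order on alternation paths and alt a k for the
-- alternating path of length k that starts with a.  A formula of Σ_k (Π_k) has the
-- single alternation path alt + k (alt − k), and every prenex transformation step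
-- only lengthens alternation paths: each path of φ embeds into a path of ψ when
-- φ ▷ ψ.  Conversely, if all alternation paths of φ embed into a path p, then
-- φ ▷* ψ for a prenex ψ whose collapsed quantifier prefix embeds into p: transform
-- the immediate subformulas first, then merge the two prefixes of a connective
-- greedily along p, always extracting next a quantifier whose sign is the current
-- head of p.  Hence PNF(φ) meets Σ_k⁺ (Π_k⁺) iff all alternation paths of φ embed
-- into alt + k (alt − k), and the six equivalences follow by bookkeeping with the
-- degree and the leading signs of the longest alternation paths.

module Submission where

open import Data.Empty using (⊥-elim)
open import Data.List using (List; []; _∷_; _++_; map; foldr; length)
open import Data.List.Membership.Propositional using (_∈_)
open import Data.List.Membership.Propositional.Properties
  using (∈-map⁺; ∈-map⁻; ∈-++⁺ˡ; ∈-++⁺ʳ; ∈-++⁻)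
open import Data.List.Properties using (map-∘; map-cong; map-id)
open import Data.List.Relation.Binary.Equality.Propositional using (≋⇒≡)
open import Data.List.Relation.Binary.Sublist.Propositional
  using (_⊆_; []; _∷_; _∷ʳ_; ⊆-refl; ⊆-reflexive; ⊆-trans; minimum)
open import Data.List.Relation.Binary.Sublist.Propositional.Properties
  using (map⁺; length-mono-≤; to-≋; ∷⁻; ∷ʳ⁻)
open import Data.List.Relation.Unary.Any using (here; there)
open import Data.Maybe using (just)
open import Data.Maybe.Properties using (just-injective)
open import Data.Nat using (ℕ; zero; suc; _≤_; _<_; _⊔_; z≤n; s≤s; _≟_)
open import Data.Nat.Properties
  using ( ≤-refl; ≤-reflexive; ≤-trans; ≤-<-trans; <-irrefl; 1+n≰n; m≤n⇒m<n∨m≡n; m≤n⇒m≤1+n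
        ; m≤m⊔n; m≤n⇒m≤n⊔o; m≤n⇒m≤o⊔n; ⊔-lub; ⊔-sel; ⊔-identityʳ)
open import Data.Product using (_×_; _,_; proj₁; proj₂; ∃-syntax)
open import Data.Sum using (_⊎_; inj₁; inj₂; [_,_])
open import Data.Unit using (tt)
open import Data.Vec using (Vec; []; _∷_)
open import Function using (id; _∘_)
open import Function.Bundles using (_⇔_; mk⇔; Equivalence)
open import Function.Properties.Equivalence using () renaming (refl to ⇔-refl; trans to ⇔-trans)
open import Relation.Binary.Construct.Closure.ReflexiveTransitive using (ε; _◅_; _◅◅_; gmap)
open import Relation.Binary.Definitions using (DecidableEquality)
open import Relation.Binary.PropositionalEquality
  using (_≡_; _≢_; refl; sym; trans; cong; cong₂; subst)
open import Relation.Nullary using (¬_; yes; no)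

open import Defs

open Equivalence using (to; from)

-- Alternation paths

swap-involutive : ∀ a → swap (swap a) ≡ a
swap-involutive plus = refl
swap-involutive minus = refl

≢-swap : ∀ a → a ≢ swap a
≢-swap plus ()
≢-swap minus ()

_≟ˢ_ : DecidableEquality Sign
plus ≟ˢ plus = yes refl
plus ≟ˢ minus = no λ ()
minus ≟ˢ plus = no λ ()
minus ≟ˢ minus = yes refl

⊥ₚ-involutive : ∀ s → (s ⊥ₚ) ⊥ₚ ≡ s
⊥ₚ-involutive s = trans (sym (map-∘ s)) (trans (map-cong swap-involutive s) (map-id s))

⊆-⊥ₚ : ∀ {s t} → s ⊆ t ⊥ₚ → s ⊥ₚ ⊆ t
⊆-⊥ₚ {s} {t} h = subst (s ⊥ₚ ⊆_) (⊥ₚ-involutive t) (map⁺ swap h)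

⊥ₚ-⊆ : ∀ {s t} → s ⊥ₚ ⊆ t → s ⊆ t ⊥ₚ
⊥ₚ-⊆ {s} {t} h = subst (_⊆ t ⊥ₚ) (⊥ₚ-involutive s) (map⁺ swap h)

⊆∧length≡⇒≡ : ∀ {s t : Path} → length s ≡ length t → s ⊆ t → s ≡ t
⊆∧length≡⇒≡ e h = ≋⇒≡ (to-≋ e h)

addSign : Sign → Path → Path
addSign plus = addPlus
addSign minus = addMinus

addSign-∷ : ∀ a s → ∃[ r ] (addSign a s ≡ a ∷ r)
addSign-∷ plus [] = [] , refl
addSign-∷ plus (plus ∷ s) = s , refl
addSign-∷ plus (minus ∷ s) = minus ∷ s , refl
addSign-∷ minus [] = [] , refl
addSign-∷ minus (plus ∷ s) = plus ∷ s , refl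
addSign-∷ minus (minus ∷ s) = s , refl

⊆-addSign : ∀ a s → s ⊆ addSign a s
⊆-addSign plus [] = plus ∷ʳ []
⊆-addSign plus (plus ∷ s) = ⊆-refl
⊆-addSign plus (minus ∷ s) = plus ∷ʳ ⊆-refl
⊆-addSign minus [] = minus ∷ʳ []
⊆-addSign minus (plus ∷ s) = minus ∷ʳ ⊆-refl
⊆-addSign minus (minus ∷ s) = ⊆-refl

addSign-⊆∷ : ∀ a {s p} → s ⊆ a ∷ p → addSign a s ⊆ a ∷ p
addSign-⊆∷ plus {[]} _ = refl ∷ minimum _
addSign-⊆∷ plus {plus ∷ s} h = h
addSign-⊆∷ plus {minus ∷ s} (_ ∷ʳ h) = refl ∷ h
addSign-⊆∷ minus {[]} _ = refl ∷ minimum _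
addSign-⊆∷ minus {plus ∷ s} (_ ∷ʳ h) = refl ∷ h
addSign-⊆∷ minus {minus ∷ s} h = h

addSign-mono : ∀ a {s t} → s ⊆ t → addSign a s ⊆ addSign a t
addSign-mono a {t = t} h with addSign a t | addSign-∷ a t | ⊆-addSign a t
... | _ | _ , refl | t⊆ = addSign-⊆∷ a (⊆-trans h t⊆)

addSign-⊥ₚ : ∀ a s → addSign a s ⊥ₚ ≡ addSign (swap a) (s ⊥ₚ)
addSign-⊥ₚ plus [] = refl
addSign-⊥ₚ plus (plus ∷ s) = refl
addSign-⊥ₚ plus (minus ∷ s) = refl
addSign-⊥ₚ minus [] = refl
addSign-⊥ₚ minus (plus ∷ s) = refl
addSign-⊥ₚ minus (minus ∷ s) = refl

addSign-⊈[] : ∀ a s → ¬ (addSign a s ⊆ [])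
addSign-⊈[] a s h with addSign a s | addSign-∷ a s
addSign-⊈[] a s () | _ | _ , refl

addSign-⊆∷⁻ : ∀ {a b s p} → b ≢ a → addSign b s ⊆ a ∷ p → addSign b s ⊆ p
addSign-⊆∷⁻ {b = b} {s} b≢a h with addSign b s | addSign-∷ b s
... | _ | _ , refl = ∷ʳ⁻ b≢a h

afterFirst : Sign → Path → Path
afterFirst a [] = []
afterFirst a (b ∷ p) with b ≟ˢ a
... | yes _ = p
... | no _ = afterFirst a p

∷-⊆-afterFirst : ∀ {a c} p → a ∷ c ⊆ p → c ⊆ afterFirst a p
∷-⊆-afterFirst {a} (b ∷ p) h with b ≟ˢ a
... | yes refl = ∷⁻ h
... | no b≢a = ∷-⊆-afterFirst p (∷ʳ⁻ (λ a≡b → b≢a (sym a≡b)) h)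

∷-afterFirst-⊆ : ∀ {a c} p → a ∷ c ⊆ p → a ∷ afterFirst a p ⊆ p
∷-afterFirst-⊆ {a} (b ∷ p) h with b ≟ˢ a
... | yes refl = ⊆-refl
... | no b≢a = b ∷ʳ ∷-afterFirst-⊆ p (∷ʳ⁻ (λ a≡b → b≢a (sym a≡b)) h)

addSign-⊆-afterFirst : ∀ a {s} p → addSign a s ⊆ p → s ⊆ a ∷ afterFirst a p
addSign-⊆-afterFirst a {s} p h with addSign a s | addSign-∷ a s | ⊆-addSign a s
... | _ | _ , refl | s⊆ = ⊆-trans s⊆ (refl ∷ ∷-⊆-afterFirst p h)

afterFirst-⊆ : ∀ a {s} p → addSign a s ⊆ p → a ∷ afterFirst a p ⊆ p
afterFirst-⊆ a {s} p h with addSign a s | addSign-∷ a s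
... | _ | _ , refl = ∷-afterFirst-⊆ p h

compress : List Sign → Path
compress = foldr addSign []

compress-⊥ₚ : ∀ qs → compress (map swap qs) ≡ compress qs ⊥ₚ
compress-⊥ₚ [] = refl
compress-⊥ₚ (a ∷ qs) =
  trans (cong (addSign (swap a)) (compress-⊥ₚ qs)) (sym (addSign-⊥ₚ a (compress qs)))

alt : Sign → ℕ → Path
alt a zero = []
alt a (suc j) = a ∷ alt (swap a) j

length-alt : ∀ a j → length (alt a j) ≡ j
length-alt a zero = refl
length-alt a (suc j) = cong suc (length-alt (swap a) j)

alt-⊥ₚ : ∀ a j → alt a j ⊥ₚ ≡ alt (swap a) j
alt-⊥ₚ a zero = refl
alt-⊥ₚ a (suc j) = cong (swap a ∷_) (alt-⊥ₚ (swap a) j)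

addSign-alt : ∀ b a j → ∃[ c ] ∃[ i ] (addSign b (alt a j) ≡ alt c i)
addSign-alt plus a zero = plus , 1 , refl
addSign-alt minus a zero = minus , 1 , refl
addSign-alt plus plus (suc j) = plus , suc j , refl
addSign-alt plus minus (suc j) = plus , suc (suc j) , refl
addSign-alt minus plus (suc j) = minus , suc (suc j) , refl
addSign-alt minus minus (suc j) = minus , suc j , refl

addSign-alt-swap : ∀ a k → addSign a (alt (swap a) k) ≡ alt a (suc k)
addSign-alt-swap plus zero = refl
addSign-alt-swap plus (suc k) = refl
addSign-alt-swap minus zero = refl
addSign-alt-swap minus (suc k) = refl

alt-mono-≤ : ∀ {a j k} → j ≤ k → alt a j ⊆ alt a k
alt-mono-≤ {j = zero} _ = minimum _
alt-mono-≤ {j = suc j} (s≤s j≤k) = refl ∷ alt-mono-≤ j≤k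

alt-mono-< : ∀ {a b j k} → j < k → alt a j ⊆ alt b k
alt-mono-< {plus} {plus} (s≤s j≤k) = alt-mono-≤ (m≤n⇒m≤1+n j≤k)
alt-mono-< {minus} {minus} (s≤s j≤k) = alt-mono-≤ (m≤n⇒m≤1+n j≤k)
alt-mono-< {plus} {minus} (s≤s j≤k) = minus ∷ʳ alt-mono-≤ j≤k
alt-mono-< {minus} {plus} (s≤s j≤k) = plus ∷ʳ alt-mono-≤ j≤k

⊆-alt⇒length≤ : ∀ {s a k} → s ⊆ alt a k → length s ≤ k
⊆-alt⇒length≤ {a = a} {k} h = subst (_ ≤_) (length-alt a k) (length-mono-≤ h)

⊆-alt⇒≡ : ∀ {s a k} → s ⊆ alt a k → length s ≡ k → s ≡ alt a k
⊆-alt⇒≡ {a = a} {k} h e = ⊆∧length≡⇒≡ (trans e (sym (length-alt a k))) h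

alt-⊆-alt⁻ : ∀ {a b j k} → alt a j ⊆ alt b k → j < k ⊎ (j ≡ k × (j ≡ 0 ⊎ a ≡ b))
alt-⊆-alt⁻ {a} {b} {j} h
  with m≤n⇒m<n∨m≡n (subst (_≤ _) (length-alt a j) (⊆-alt⇒length≤ h))
... | inj₁ j<k = inj₁ j<k
... | inj₂ refl with j | ⊆-alt⇒≡ h (length-alt a j)
...   | zero | _ = inj₂ (refl , inj₁ refl)
...   | suc _ | refl = inj₂ (refl , inj₂ refl)

alt-⊆-both : ∀ {a b c j k} → a ≢ b → alt c j ⊆ alt a (suc k) → alt c j ⊆ alt b (suc k) → j ≤ k
alt-⊆-both a≢b h₁ h₂ with alt-⊆-alt⁻ h₁ | alt-⊆-alt⁻ h₂
... | inj₁ (s≤s j≤k) | _ = j≤k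
... | inj₂ (_ , inj₂ _) | inj₁ (s≤s j≤k) = j≤k
... | inj₂ (_ , inj₂ refl) | inj₂ (_ , inj₂ refl) = ⊥-elim (a≢b refl)
... | inj₂ (refl , inj₁ ()) | _
... | inj₂ (refl , inj₂ _) | inj₂ (_ , inj₁ ())

maxLength : List Path → ℕ
maxLength = foldr (λ s m → length s ⊔ m) 0

length≤maxLength : ∀ {s} A → s ∈ A → length s ≤ maxLength A
length≤maxLength (t ∷ A) (here refl) = m≤m⊔n (length t) (maxLength A)
length≤maxLength (t ∷ A) (there s∈) = m≤n⇒m≤o⊔n (length t) (length≤maxLength A s∈)

maxLength≤ : ∀ {k} A → (∀ {s} → s ∈ A → length s ≤ k) → maxLength A ≤ k
maxLength≤ [] _ = z≤n
maxLength≤ (t ∷ A) h = ⊔-lub (h (here refl)) (maxLength≤ A (λ s∈ → h (there s∈)))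

maxLength-attained : ∀ {s} A → s ∈ A → ∃[ t ] (t ∈ A × length t ≡ maxLength A)
maxLength-attained (t ∷ A) _ = attained t A
  where
  attained : ∀ t A → ∃[ u ] (u ∈ t ∷ A × length u ≡ maxLength (t ∷ A))
  attained t [] = t , here refl , sym (⊔-identityʳ (length t))
  attained t (u ∷ A) with ⊔-sel (length t) (maxLength (u ∷ A))
  ... | inj₁ e = t , here refl , sym e
  ... | inj₂ e with attained u A
  ...   | v , v∈ , len = v , there v∈ , trans len (sym e)

-- Prenex transformations only lengthen alternation paths

infix 4 _⊑_

_⊑_ : List Path → List Path → Set
A ⊑ B = ∀ {s} → s ∈ A → ∃[ t ] (t ∈ B × s ⊆ t)

⊑-refl : ∀ {A} → A ⊑ A
⊑-refl {s = s} s∈ = s , s∈ , ⊆-refl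

⊑-trans : ∀ {A B C} → A ⊑ B → B ⊑ C → A ⊑ C
⊑-trans A⊑B B⊑C s∈ with A⊑B s∈
... | t , t∈ , s⊆t with B⊑C t∈
...   | u , u∈ , t⊆u = u , u∈ , ⊆-trans s⊆t t⊆u

map⁺-⊑ : ∀ f → (∀ {s t} → s ⊆ t → f s ⊆ f t) → ∀ {A B} → A ⊑ B → map f A ⊑ map f B
map⁺-⊑ f f-mono A⊑B s∈ with ∈-map⁻ f s∈
... | s , s∈A , refl with A⊑B s∈A
...   | t , t∈ , s⊆t = f t , ∈-map⁺ f t∈ , f-mono s⊆t

++⁺-⊑ : ∀ A {A′ B B′} → A ⊑ A′ → B ⊑ B′ → A ++ B ⊑ A′ ++ B′
++⁺-⊑ A {A′} A⊑ B⊑ s∈ with ∈-++⁻ A s∈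
... | inj₁ s∈A with A⊑ s∈A
...   | t , t∈ , s⊆t = t , ∈-++⁺ˡ t∈ , s⊆t
++⁺-⊑ A {A′} A⊑ B⊑ s∈ | inj₂ s∈B with B⊑ s∈B
...   | t , t∈ , s⊆t = t , ∈-++⁺ʳ A′ t∈ , s⊆t

addSign-extractˡ-⊑ : ∀ a B D → map (addSign a) B ++ D ⊑ map (addSign a) (B ++ D)
addSign-extractˡ-⊑ a B D s∈ with ∈-++⁻ (map (addSign a) B) s∈
... | inj₁ s∈B with ∈-map⁻ (addSign a) s∈B
...   | s , s∈′ , refl = addSign a s , ∈-map⁺ (addSign a) (∈-++⁺ˡ s∈′) , ⊆-refl
addSign-extractˡ-⊑ a B D {s} s∈ | inj₂ s∈D =
  addSign a s , ∈-map⁺ (addSign a) (∈-++⁺ʳ B s∈D) , ⊆-addSign a s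

addSign-extractʳ-⊑ : ∀ a D B → D ++ map (addSign a) B ⊑ map (addSign a) (D ++ B)
addSign-extractʳ-⊑ a D B {s} s∈ with ∈-++⁻ D s∈
... | inj₁ s∈D = addSign a s , ∈-map⁺ (addSign a) (∈-++⁺ˡ s∈D) , ⊆-addSign a s
... | inj₂ s∈B with ∈-map⁻ (addSign a) s∈B
...   | s , s∈′ , refl = addSign a s , ∈-map⁺ (addSign a) (∈-++⁺ʳ D s∈′) , ⊆-refl

addSign-extract⇒-⊑ : ∀ a B D →
  map _⊥ₚ (map (addSign a) B) ++ D ⊑ map (addSign (swap a)) (map _⊥ₚ B ++ D)
addSign-extract⇒-⊑ a B D s∈ with ∈-++⁻ (map _⊥ₚ (map (addSign a) B)) s∈
... | inj₁ s∈B with ∈-map⁻ _⊥ₚ s∈B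
...   | _ , s∈′ , refl with ∈-map⁻ (addSign a) s∈′
...     | s , s∈″ , refl =
  addSign (swap a) (s ⊥ₚ) , ∈-map⁺ (addSign (swap a)) (∈-++⁺ˡ (∈-map⁺ _⊥ₚ s∈″)) ,
  subst (_⊆ addSign (swap a) (s ⊥ₚ)) (sym (addSign-⊥ₚ a s)) ⊆-refl
addSign-extract⇒-⊑ a B D {s} s∈ | inj₂ s∈D =
  addSign (swap a) s , ∈-map⁺ (addSign (swap a)) (∈-++⁺ʳ (map _⊥ₚ B) s∈D) , ⊆-addSign (swap a) s

module _ {L : Signature} where

  quantifierOf : Sign → Quant {L}
  quantifierOf plus = qEx
  quantifierOf minus = qAll

  quant : Sign → Var → Formula L → Formula L
  quant a = Q[ quantifierOf a ]

  Alt-ren : ∀ x y (φ : Formula L) → Alt (ren x y φ) ≡ Alt φ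
  Alt-ren x y (rel R ts) = refl
  Alt-ren x y bot = refl
  Alt-ren x y (φ ⇒ ψ) = cong₂ (λ A B → map _⊥ₚ A ++ B) (Alt-ren x y φ) (Alt-ren x y ψ)
  Alt-ren x y (φ ∧ ψ) = cong₂ _++_ (Alt-ren x y φ) (Alt-ren x y ψ)
  Alt-ren x y (φ ∨ ψ) = cong₂ _++_ (Alt-ren x y φ) (Alt-ren x y ψ)
  Alt-ren x y (all z φ) with z ≟ x
  ... | yes _ = refl
  ... | no _ = cong (map addMinus) (Alt-ren x y φ)
  Alt-ren x y (ex z φ) with z ≟ x
  ... | yes _ = refl
  ... | no _ = cong (map addPlus) (Alt-ren x y φ)

  ▷⇒Alt⊑ : {φ ψ : Formula L} → φ ▷ ψ → Alt φ ⊑ Alt ψ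
  ▷⇒Alt⊑ (exImp {ξ = ξ} {δ} _) = addSign-extract⇒-⊑ plus (Alt ξ) (Alt δ)
  ▷⇒Alt⊑ (allImp {ξ = ξ} {δ} _) = addSign-extract⇒-⊑ minus (Alt ξ) (Alt δ)
  ▷⇒Alt⊑ (impQ {qAll} {ξ = ξ} {δ} _) = addSign-extractʳ-⊑ minus (map _⊥ₚ (Alt δ)) (Alt ξ)
  ▷⇒Alt⊑ (impQ {qEx} {ξ = ξ} {δ} _) = addSign-extractʳ-⊑ plus (map _⊥ₚ (Alt δ)) (Alt ξ)
  ▷⇒Alt⊑ (andQL {qAll} {ξ = ξ} {δ} _) = addSign-extractˡ-⊑ minus (Alt ξ) (Alt δ)
  ▷⇒Alt⊑ (andQL {qEx} {ξ = ξ} {δ} _) = addSign-extractˡ-⊑ plus (Alt ξ) (Alt δ)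
  ▷⇒Alt⊑ (andQR {qAll} {ξ = ξ} {δ} _) = addSign-extractʳ-⊑ minus (Alt δ) (Alt ξ)
  ▷⇒Alt⊑ (andQR {qEx} {ξ = ξ} {δ} _) = addSign-extractʳ-⊑ plus (Alt δ) (Alt ξ)
  ▷⇒Alt⊑ (orQL {qAll} {ξ = ξ} {δ} _) = addSign-extractˡ-⊑ minus (Alt ξ) (Alt δ)
  ▷⇒Alt⊑ (orQL {qEx} {ξ = ξ} {δ} _) = addSign-extractˡ-⊑ plus (Alt ξ) (Alt δ)
  ▷⇒Alt⊑ (orQR {qAll} {ξ = ξ} {δ} _) = addSign-extractʳ-⊑ minus (Alt δ) (Alt ξ)
  ▷⇒Alt⊑ (orQR {qEx} {ξ = ξ} {δ} _) = addSign-extractʳ-⊑ plus (Alt δ) (Alt ξ)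
  ▷⇒Alt⊑ (rename {qAll} {x} {y} {ξ} _) rewrite Alt-ren x y ξ = ⊑-refl
  ▷⇒Alt⊑ (rename {qEx} {x} {y} {ξ} _) rewrite Alt-ren x y ξ = ⊑-refl

  ⟶⇒Alt⊑ : {φ ψ : Formula L} → φ ⟶ ψ → Alt φ ⊑ Alt ψ
  ⟶⇒Alt⊑ (base r) = ▷⇒Alt⊑ r
  ⟶⇒Alt⊑ (impL {φ = φ} r) = ++⁺-⊑ (map _⊥ₚ (Alt φ)) (map⁺-⊑ _⊥ₚ (map⁺ swap) (⟶⇒Alt⊑ r)) ⊑-refl
  ⟶⇒Alt⊑ (impR {φ = φ} r) = ++⁺-⊑ (map _⊥ₚ (Alt φ)) ⊑-refl (⟶⇒Alt⊑ r)
  ⟶⇒Alt⊑ (andL {φ = φ} r) = ++⁺-⊑ (Alt φ) (⟶⇒Alt⊑ r) ⊑-refl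
  ⟶⇒Alt⊑ (andR {φ = φ} r) = ++⁺-⊑ (Alt φ) ⊑-refl (⟶⇒Alt⊑ r)
  ⟶⇒Alt⊑ (orL {φ = φ} r) = ++⁺-⊑ (Alt φ) (⟶⇒Alt⊑ r) ⊑-refl
  ⟶⇒Alt⊑ (orR {φ = φ} r) = ++⁺-⊑ (Alt φ) ⊑-refl (⟶⇒Alt⊑ r)
  ⟶⇒Alt⊑ (inAll r) = map⁺-⊑ addMinus (addSign-mono minus) (⟶⇒Alt⊑ r)
  ⟶⇒Alt⊑ (inEx r) = map⁺-⊑ addPlus (addSign-mono plus) (⟶⇒Alt⊑ r)

  ▷*⇒Alt⊑ : {φ ψ : Formula L} → φ ▷* ψ → Alt φ ⊑ Alt ψ
  ▷*⇒Alt⊑ ε = ⊑-refl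
  ▷*⇒Alt⊑ (r ◅ rs) = ⊑-trans (⟶⇒Alt⊑ r) (▷*⇒Alt⊑ rs)

  AltWithin : Formula L → Path → Set
  AltWithin φ p = ∀ {s} → s ∈ Alt φ → s ⊆ p

  within-▷* : ∀ {φ ψ : Formula L} {p} → φ ▷* ψ → AltWithin ψ p → AltWithin φ p
  within-▷* r w s∈ with ▷*⇒Alt⊑ r s∈
  ... | t , t∈ , s⊆t = ⊆-trans s⊆t (w t∈)

  -- Alternation paths of prenex formulas

  block : Sign → List Var → Formula L → Formula L
  block plus = exs
  block minus = alls

  Class : Sign → ℕ → Formula L → Set
  Class plus = SigmaC
  Class minus = PiC

  -- Shaped so that Class⁺ plus and Class⁺ minus are SigmaC⁺ and PiC⁺ definitionally.
  Lower : ℕ → Formula L → Set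
  Lower k ψ = ∃[ i ] (i < k × (SigmaC i ψ ⊎ PiC i ψ))

  Class⁺ : Sign → ℕ → Formula L → Set
  Class⁺ a k ψ = Class a k ψ ⊎ Lower k ψ

  Uniform : Formula L → Path → Set
  Uniform φ p = ∀ {s} → s ∈ Alt φ → s ≡ p

  QF⇒uniform : ∀ {φ : Formula L} → QF φ → Uniform φ []
  QF⇒uniform {rel R ts} _ (here refl) = refl
  QF⇒uniform {bot} _ (here refl) = refl
  QF⇒uniform {φ ⇒ ψ} (qφ , qψ) s∈ with ∈-++⁻ (map _⊥ₚ (Alt φ)) s∈
  ... | inj₁ s∈φ with ∈-map⁻ _⊥ₚ s∈φ
  ...   | _ , s∈′ , refl = cong _⊥ₚ (QF⇒uniform qφ s∈′)
  QF⇒uniform {φ ⇒ ψ} (qφ , qψ) s∈ | inj₂ s∈ψ = QF⇒uniform qψ s∈ψ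
  QF⇒uniform {φ ∧ ψ} (qφ , qψ) s∈ with ∈-++⁻ (Alt φ) s∈
  ... | inj₁ s∈φ = QF⇒uniform qφ s∈φ
  ... | inj₂ s∈ψ = QF⇒uniform qψ s∈ψ
  QF⇒uniform {φ ∨ ψ} (qφ , qψ) s∈ with ∈-++⁻ (Alt φ) s∈
  ... | inj₁ s∈φ = QF⇒uniform qφ s∈φ
  ... | inj₂ s∈ψ = QF⇒uniform qψ s∈ψ

  uniform-quant : ∀ a x φ {p} → Uniform φ p → Uniform (quant a x φ) (addSign a p)
  uniform-quant plus x φ u s∈ with ∈-map⁻ addPlus s∈
  ... | _ , s∈′ , refl = cong addPlus (u s∈′)
  uniform-quant minus x φ u s∈ with ∈-map⁻ addMinus s∈
  ... | _ , s∈′ , refl = cong addMinus (u s∈′)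

  uniform-block : ∀ a x xs χ {k} →
    Uniform χ (alt (swap a) k) → Uniform (block a (x ∷ xs) χ) (alt a (suc k))
  uniform-block plus x [] χ {k} u =
    subst (Uniform (ex x χ)) (addSign-alt-swap plus k) (uniform-quant plus x χ u)
  uniform-block plus x (y ∷ xs) χ u =
    uniform-quant plus x (exs (y ∷ xs) χ) (uniform-block plus y xs χ u)
  uniform-block minus x [] χ {k} u =
    subst (Uniform (all x χ)) (addSign-alt-swap minus k) (uniform-quant minus x χ u)
  uniform-block minus x (y ∷ xs) χ u =
    uniform-quant minus x (alls (y ∷ xs) χ) (uniform-block minus y xs χ u)

  Alt-class : ∀ a j {ψ} → Class a j ψ → Uniform ψ (alt a j)
  Alt-class plus zero q = QF⇒uniform q
  Alt-class minus zero q = QF⇒uniform q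
  Alt-class plus (suc k) (x , xs , χ , c , refl) = uniform-block plus x xs χ (Alt-class minus k c)
  Alt-class minus (suc k) (x , xs , χ , c , refl) = uniform-block minus x xs χ (Alt-class plus k c)

  class⁺⇒within : ∀ a k {ψ : Formula L} → Class⁺ a k ψ → AltWithin ψ (alt a k)
  class⁺⇒within a k (inj₁ c) s∈ = ⊆-reflexive (Alt-class a k c s∈)
  class⁺⇒within a k (inj₂ (i , i<k , inj₁ c)) s∈ rewrite Alt-class plus i c s∈ = alt-mono-< i<k
  class⁺⇒within a k (inj₂ (i , i<k , inj₂ c)) s∈ rewrite Alt-class minus i c s∈ = alt-mono-< i<k

  meets⇒within : ∀ a k {φ : Formula L} → PNFMeets φ (Class⁺ a k) → AltWithin φ (alt a k)
  meets⇒within a k (ψ , r , _ , c) = within-▷* r (class⁺⇒within a k c)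

-- Constructing prenex forms

data Op : Set where
  impₒ andₒ orₒ : Op

polarity : Op → Sign → Sign
polarity impₒ = swap
polarity andₒ = id
polarity orₒ = id

module _ {L : Signature} where

  mutual
    termVarBound : Term L → ℕ
    termVarBound (var x) = x
    termVarBound (app f ts) = termsVarBound ts

    termsVarBound : ∀ {n} → Vec (Term L) n → ℕ
    termsVarBound [] = 0
    termsVarBound (t ∷ ts) = termVarBound t ⊔ termsVarBound ts

  mutual
    occT⇒≤termVarBound : ∀ {x t} → OccT x t → x ≤ termVarBound t
    occT⇒≤termVarBound here = ≤-refl
    occT⇒≤termVarBound (inApp o) = occTs⇒≤termsVarBound o

    occTs⇒≤termsVarBound : ∀ {x n} {ts : Vec (Term L) n} → OccTs x ts → x ≤ termsVarBound ts
    occTs⇒≤termsVarBound {ts = t ∷ ts} (hd o) = m≤n⇒m≤n⊔o (termsVarBound ts) (occT⇒≤termVarBound o)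
    occTs⇒≤termsVarBound {ts = t ∷ ts} (tl o) = m≤n⇒m≤o⊔n (termVarBound t) (occTs⇒≤termsVarBound o)

  varBound : Formula L → ℕ
  varBound (rel R ts) = termsVarBound ts
  varBound bot = 0
  varBound (φ ⇒ ψ) = varBound φ ⊔ varBound ψ
  varBound (φ ∧ ψ) = varBound φ ⊔ varBound ψ
  varBound (φ ∨ ψ) = varBound φ ⊔ varBound ψ
  varBound (all x φ) = x ⊔ varBound φ
  varBound (ex x φ) = x ⊔ varBound φ

  occurs⇒≤varBound : ∀ {x} {φ : Formula L} → Occurs x φ → x ≤ varBound φ
  occurs⇒≤varBound (oRel o) = occTs⇒≤termsVarBound o
  occurs⇒≤varBound {φ = φ ⇒ ψ} (oImpL o) = m≤n⇒m≤n⊔o (varBound ψ) (occurs⇒≤varBound o)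
  occurs⇒≤varBound {φ = φ ⇒ ψ} (oImpR o) = m≤n⇒m≤o⊔n (varBound φ) (occurs⇒≤varBound o)
  occurs⇒≤varBound {φ = φ ∧ ψ} (oAndL o) = m≤n⇒m≤n⊔o (varBound ψ) (occurs⇒≤varBound o)
  occurs⇒≤varBound {φ = φ ∧ ψ} (oAndR o) = m≤n⇒m≤o⊔n (varBound φ) (occurs⇒≤varBound o)
  occurs⇒≤varBound {φ = φ ∨ ψ} (oOrL o) = m≤n⇒m≤n⊔o (varBound ψ) (occurs⇒≤varBound o)
  occurs⇒≤varBound {φ = φ ∨ ψ} (oOrR o) = m≤n⇒m≤o⊔n (varBound φ) (occurs⇒≤varBound o)
  occurs⇒≤varBound {φ = all x φ} oAllB = m≤m⊔n x (varBound φ)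
  occurs⇒≤varBound {φ = all x φ} (oAll o) = m≤n⇒m≤o⊔n x (occurs⇒≤varBound o)
  occurs⇒≤varBound {φ = ex x φ} oExB = m≤m⊔n x (varBound φ)
  occurs⇒≤varBound {φ = ex x φ} (oEx o) = m≤n⇒m≤o⊔n x (occurs⇒≤varBound o)

  free⇒occurs : ∀ {x} {φ : Formula L} → Free x φ → Occurs x φ
  free⇒occurs (fRel o) = oRel o
  free⇒occurs (fImpL f) = oImpL (free⇒occurs f)
  free⇒occurs (fImpR f) = oImpR (free⇒occurs f)
  free⇒occurs (fAndL f) = oAndL (free⇒occurs f)
  free⇒occurs (fAndR f) = oAndR (free⇒occurs f)
  free⇒occurs (fOrL f) = oOrL (free⇒occurs f)
  free⇒occurs (fOrR f) = oOrR (free⇒occurs f)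
  free⇒occurs (fAll _ f) = oAll (free⇒occurs f)
  free⇒occurs (fEx _ f) = oEx (free⇒occurs f)

  fresh : Formula L → Formula L → Var
  fresh α β = suc (varBound α ⊔ varBound β)

  fresh-∉ˡ : ∀ α β → ¬ Occurs (fresh α β) α
  fresh-∉ˡ α β o = 1+n≰n (m≤n⇒m≤n⊔o (varBound β) (occurs⇒≤varBound o))

  fresh-∉ʳ : ∀ α β → ¬ Occurs (fresh α β) β
  fresh-∉ʳ α β o = 1+n≰n (m≤n⇒m≤o⊔n (varBound α) (occurs⇒≤varBound o))

  data Prefixed : List Sign → Formula L → Set where
    qf : ∀ {φ} → QF φ → Prefixed [] φ
    bind : ∀ a {x qs φ} → Prefixed qs φ → Prefixed (a ∷ qs) (quant a x φ)

  QF-ren : ∀ x y (φ : Formula L) → QF φ → QF (ren x y φ)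
  QF-ren x y (rel R ts) _ = tt
  QF-ren x y bot _ = tt
  QF-ren x y (φ ⇒ ψ) (qφ , qψ) = QF-ren x y φ qφ , QF-ren x y ψ qψ
  QF-ren x y (φ ∧ ψ) (qφ , qψ) = QF-ren x y φ qφ , QF-ren x y ψ qψ
  QF-ren x y (φ ∨ ψ) (qφ , qψ) = QF-ren x y φ qφ , QF-ren x y ψ qψ

  Prefixed-ren : ∀ x y {qs φ} → Prefixed qs φ → Prefixed qs (ren x y φ)
  Prefixed-ren x y {φ = φ} (qf q) = qf (QF-ren x y φ q)
  Prefixed-ren x y (bind plus {z} P) with z ≟ x
  ... | yes _ = bind plus P
  ... | no _ = bind plus (Prefixed-ren x y P)
  Prefixed-ren x y (bind minus {z} P) with z ≟ x
  ... | yes _ = bind minus P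
  ... | no _ = bind minus (Prefixed-ren x y P)

  _⊙[_]_ : Formula L → Op → Formula L → Formula L
  α ⊙[ impₒ ] β = α ⇒ β
  α ⊙[ andₒ ] β = α ∧ β
  α ⊙[ orₒ ] β = α ∨ β

  QF-⊙ : ∀ o {α β : Formula L} → QF α → QF β → QF (α ⊙[ o ] β)
  QF-⊙ impₒ qα qβ = qα , qβ
  QF-⊙ andₒ qα qβ = qα , qβ
  QF-⊙ orₒ qα qβ = qα , qβ

  ⟶-⊙ˡ : ∀ o {α α′ β : Formula L} → α ⟶ α′ → (α ⊙[ o ] β) ⟶ (α′ ⊙[ o ] β)
  ⟶-⊙ˡ impₒ = impL
  ⟶-⊙ˡ andₒ = andL
  ⟶-⊙ˡ orₒ = orL

  ⟶-⊙ʳ : ∀ o {α β β′ : Formula L} → β ⟶ β′ → (α ⊙[ o ] β) ⟶ (α ⊙[ o ] β′)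
  ⟶-⊙ʳ impₒ = impR
  ⟶-⊙ʳ andₒ = andR
  ⟶-⊙ʳ orₒ = orR

  ⟶-quant : ∀ a {x} {φ φ′ : Formula L} → φ ⟶ φ′ → quant a x φ ⟶ quant a x φ′
  ⟶-quant plus = inEx
  ⟶-quant minus = inAll

  extractˡ : ∀ o b {x} {α β : Formula L} → ¬ Free x β →
    (quant b x α ⊙[ o ] β) ▷ quant (polarity o b) x (α ⊙[ o ] β)
  extractˡ impₒ plus = exImp
  extractˡ impₒ minus = allImp
  extractˡ andₒ b = andQL {Q = quantifierOf b}
  extractˡ orₒ b = orQL {Q = quantifierOf b}

  extractʳ : ∀ o b {x} {α β : Formula L} → ¬ Free x α →
    (α ⊙[ o ] quant b x β) ▷ quant b x (α ⊙[ o ] β)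
  extractʳ impₒ b = impQ {Q = quantifierOf b}
  extractʳ andₒ b = andQR {Q = quantifierOf b}
  extractʳ orₒ b = orQR {Q = quantifierOf b}

  pullˡ : ∀ o {b qs α} (β : Formula L) → Prefixed (b ∷ qs) α →
    ∃[ y ] ∃[ α′ ] ((α ⊙[ o ] β) ▷* quant (polarity o b) y (α′ ⊙[ o ] β) × Prefixed qs α′)
  pullˡ o β (bind b {x} {φ = α} P) =
    y , ren x y α ,
    ⟶-⊙ˡ o (base (rename {Q = quantifierOf b} (fresh-∉ˡ α β))) ◅
    base (extractˡ o b (fresh-∉ʳ α β ∘ free⇒occurs)) ◅ ε ,
    Prefixed-ren x y P
    where y = fresh α β

  pullʳ : ∀ o {b qs β} (α : Formula L) → Prefixed (b ∷ qs) β →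
    ∃[ y ] ∃[ β′ ] ((α ⊙[ o ] β) ▷* quant b y (α ⊙[ o ] β′) × Prefixed qs β′)
  pullʳ o α (bind b {x} {φ = β} P) =
    y , ren x y β ,
    ⟶-⊙ʳ o (base (rename {Q = quantifierOf b} (fresh-∉ˡ β α))) ◅
    base (extractʳ o b (fresh-∉ʳ β α ∘ free⇒occurs)) ◅ ε ,
    Prefixed-ren x y P
    where y = fresh β α

  PrenexBelow : Formula L → Path → Set
  PrenexBelow φ p = ∃[ qs ] ∃[ ψ ] (φ ▷* ψ × Prefixed qs ψ × compress qs ⊆ p)

  below-weaken : ∀ {φ p p′} → p ⊆ p′ → PrenexBelow φ p → PrenexBelow φ p′
  below-weaken p⊆ (qs , ψ , r , P , h) = qs , ψ , r , P , ⊆-trans h p⊆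

  below-quant : ∀ {a c φ χ y p} → c ≡ a → φ ▷* quant c y χ →
    PrenexBelow χ (a ∷ p) → PrenexBelow φ (a ∷ p)
  below-quant {c = c} refl r (qs , ψ , r′ , P , h) =
    c ∷ qs , quant c _ ψ , r ◅◅ gmap _ (⟶-quant c) r′ , bind c P , addSign-⊆∷ c h

  mutual
    merge : ∀ o p {qs₁ qs₂ α β} → Prefixed qs₁ α → Prefixed qs₂ β →
      compress (map (polarity o) qs₁) ⊆ p → compress qs₂ ⊆ p → PrenexBelow (α ⊙[ o ] β) p
    merge o [] (qf q₁) (qf q₂) _ _ = [] , _ , ε , qf (QF-⊙ o q₁ q₂) , []
    merge o [] (bind b {qs = qs} _) _ h₁ _ =
      ⊥-elim (addSign-⊈[] (polarity o b) (compress (map (polarity o) qs)) h₁)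
    merge o [] (qf _) (bind c {qs = qs} _) _ h₂ = ⊥-elim (addSign-⊈[] c (compress qs) h₂)
    merge o (a ∷ p) P₁ P₂ h₁ h₂ = merge∷ o a p P₁ P₂ h₁ h₂

    -- Greedy merge: extract a leading quantifier of sign a (the head of the target path)
    -- from the left, else from the right; if neither side has one, a is skipped.
    merge∷ : ∀ o a p {qs₁ qs₂ α β} → Prefixed qs₁ α → Prefixed qs₂ β →
      compress (map (polarity o) qs₁) ⊆ a ∷ p → compress qs₂ ⊆ a ∷ p →
      PrenexBelow (α ⊙[ o ] β) (a ∷ p)
    merge∷ o a p {[]} P₁ P₂ _ h₂ = merge∷ʳ o a p P₁ P₂ (minimum p) h₂
    merge∷ o a p {b ∷ qs₁} {β = β} P₁ P₂ h₁ h₂ with polarity o b ≟ˢ a | pullˡ o β P₁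
    ... | no b≢a | _ = merge∷ʳ o a p P₁ P₂ (addSign-⊆∷⁻ b≢a h₁) h₂
    ... | yes b≡a | _ , _ , r , P₁′ =
      below-quant b≡a r (merge∷ o a p P₁′ P₂ (⊆-trans (⊆-addSign (polarity o b) _) h₁) h₂)

    merge∷ʳ : ∀ o a p {qs₁ qs₂ α β} → Prefixed qs₁ α → Prefixed qs₂ β →
      compress (map (polarity o) qs₁) ⊆ p → compress qs₂ ⊆ a ∷ p →
      PrenexBelow (α ⊙[ o ] β) (a ∷ p)
    merge∷ʳ o a p {qs₂ = []} P₁ P₂ h₁ _ =
      below-weaken (a ∷ʳ ⊆-refl) (merge o p P₁ P₂ h₁ (minimum p))
    merge∷ʳ o a p {qs₂ = c ∷ qs₂} {α} P₁ P₂ h₁ h₂ with c ≟ˢ a | pullʳ o α P₂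
    ... | no c≢a | _ = below-weaken (a ∷ʳ ⊆-refl) (merge o p P₁ P₂ h₁ (addSign-⊆∷⁻ c≢a h₂))
    ... | yes c≡a | _ , _ , r , P₂′ =
      below-quant c≡a r (merge∷ o a p P₁ P₂′ (a ∷ʳ h₁) (⊆-trans (⊆-addSign c _) h₂))

  below-⊙ : ∀ o {α β : Formula L} {p qs₁ ψ₁} → α ▷* ψ₁ → Prefixed qs₁ ψ₁ →
    compress (map (polarity o) qs₁) ⊆ p → PrenexBelow β p → PrenexBelow (α ⊙[ o ] β) p
  below-⊙ o r₁ P₁ h₁ (_ , _ , r₂ , P₂ , h₂) with merge o _ P₁ P₂ h₁ h₂
  ... | qs , ψ , r , P , h = qs , ψ , gmap _ (⟶-⊙ˡ o) r₁ ◅◅ gmap _ (⟶-⊙ʳ o) r₂ ◅◅ r , P , h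

  Alt-nonempty : ∀ (φ : Formula L) → ∃[ s ] (s ∈ Alt φ)
  Alt-nonempty (rel R ts) = [] , here refl
  Alt-nonempty bot = [] , here refl
  Alt-nonempty (φ ⇒ ψ) with Alt-nonempty ψ
  ... | s , s∈ = s , ∈-++⁺ʳ (map _⊥ₚ (Alt φ)) s∈
  Alt-nonempty (φ ∧ ψ) with Alt-nonempty φ
  ... | s , s∈ = s , ∈-++⁺ˡ s∈
  Alt-nonempty (φ ∨ ψ) with Alt-nonempty φ
  ... | s , s∈ = s , ∈-++⁺ˡ s∈
  Alt-nonempty (all x φ) with Alt-nonempty φ
  ... | s , s∈ = addMinus s , ∈-map⁺ addMinus s∈
  Alt-nonempty (ex x φ) with Alt-nonempty φ
  ... | s , s∈ = addPlus s , ∈-map⁺ addPlus s∈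

  below-bind : ∀ a {x} {φ : Formula L} {p} → (∀ {s} → s ∈ Alt φ → addSign a s ⊆ p) →
    (∀ {p′} → AltWithin φ p′ → PrenexBelow φ p′) → PrenexBelow (quant a x φ) p
  below-bind a {φ = φ} {p} w below with Alt-nonempty φ
  ... | _ , s∈ =
    below-weaken (afterFirst-⊆ a p (w s∈))
      (below-quant refl ε (below (λ t∈ → addSign-⊆-afterFirst a p (w t∈))))

  prenexBelow : ∀ (φ : Formula L) {p} → AltWithin φ p → PrenexBelow φ p
  prenexBelow (rel R ts) _ = [] , rel R ts , ε , qf tt , minimum _
  prenexBelow bot _ = [] , bot , ε , qf tt , minimum _
  prenexBelow (α ⇒ β) {p} w
    with prenexBelow α {p ⊥ₚ} (λ s∈ → ⊥ₚ-⊆ (w (∈-++⁺ˡ (∈-map⁺ _⊥ₚ s∈))))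
  ... | qs₁ , _ , r₁ , P₁ , h₁ =
    below-⊙ impₒ r₁ P₁ (subst (_⊆ p) (sym (compress-⊥ₚ qs₁)) (⊆-⊥ₚ h₁))
      (prenexBelow β (λ s∈ → w (∈-++⁺ʳ (map _⊥ₚ (Alt α)) s∈)))
  prenexBelow (α ∧ β) {p} w with prenexBelow α (λ s∈ → w (∈-++⁺ˡ s∈))
  ... | qs₁ , _ , r₁ , P₁ , h₁ =
    below-⊙ andₒ r₁ P₁ (subst (λ qs → compress qs ⊆ p) (sym (map-id qs₁)) h₁)
      (prenexBelow β (λ s∈ → w (∈-++⁺ʳ (Alt α) s∈)))
  prenexBelow (α ∨ β) {p} w with prenexBelow α (λ s∈ → w (∈-++⁺ˡ s∈))
  ... | qs₁ , _ , r₁ , P₁ , h₁ =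
    below-⊙ orₒ r₁ P₁ (subst (λ qs → compress qs ⊆ p) (sym (map-id qs₁)) h₁)
      (prenexBelow β (λ s∈ → w (∈-++⁺ʳ (Alt α) s∈)))
  prenexBelow (all x φ) w = below-bind minus (λ s∈ → w (∈-map⁺ addMinus s∈)) (prenexBelow φ)
  prenexBelow (ex x φ) w = below-bind plus (λ s∈ → w (∈-map⁺ addPlus s∈)) (prenexBelow φ)

  class⇒Σ⊎Π : ∀ a {j} {ψ : Formula L} → Class a j ψ → SigmaC j ψ ⊎ PiC j ψ
  class⇒Σ⊎Π plus = inj₁
  class⇒Σ⊎Π minus = inj₂

  class₀ : ∀ b a {ψ : Formula L} → Class b 0 ψ → Class a 0 ψ
  class₀ plus plus q = q
  class₀ plus minus q = q
  class₀ minus plus q = q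
  class₀ minus minus q = q

  prefixed⇒class : ∀ {qs} {ψ : Formula L} → Prefixed qs ψ →
    ∃[ a ] ∃[ j ] (Class a j ψ × compress qs ≡ alt a j)
  prefixed⇒class (qf q) = plus , 0 , q , refl
  prefixed⇒class (bind plus {x} {φ = χ} P) with prefixed⇒class P
  ... | plus , zero , c , e = plus , 1 , (x , [] , χ , c , refl) , cong addPlus e
  ... | minus , zero , c , e = plus , 1 , (x , [] , χ , c , refl) , cong addPlus e
  ... | plus , suc j , (y , ys , χ′ , c , refl) , e =
    plus , suc j , (x , y ∷ ys , χ′ , c , refl) , cong addPlus e
  ... | minus , suc j , c , e = plus , suc (suc j) , (x , [] , χ , c , refl) , cong addPlus e
  prefixed⇒class (bind minus {x} {φ = χ} P) with prefixed⇒class P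
  ... | plus , zero , c , e = minus , 1 , (x , [] , χ , c , refl) , cong addMinus e
  ... | minus , zero , c , e = minus , 1 , (x , [] , χ , c , refl) , cong addMinus e
  ... | minus , suc j , (y , ys , χ′ , c , refl) , e =
    minus , suc j , (x , y ∷ ys , χ′ , c , refl) , cong addMinus e
  ... | plus , suc j , c , e = minus , suc (suc j) , (x , [] , χ , c , refl) , cong addMinus e

  class⇒class⁺ : ∀ a k {b j} {ψ : Formula L} → Class b j ψ → alt b j ⊆ alt a k → Class⁺ a k ψ
  class⇒class⁺ a k {b} {j} c h with alt-⊆-alt⁻ h
  ... | inj₁ j<k = inj₂ (j , j<k , class⇒Σ⊎Π b c)
  ... | inj₂ (refl , inj₁ refl) = inj₁ (class₀ b a c)
  ... | inj₂ (refl , inj₂ refl) = inj₁ c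

  within⇒meets : ∀ a k {φ : Formula L} → AltWithin φ (alt a k) → PNFMeets φ (Class⁺ a k)
  within⇒meets a k {φ} w with prenexBelow φ w
  ... | qs , ψ , r , P , h with prefixed⇒class P
  ...   | b , j , c , e = ψ , r , (j , class⇒Σ⊎Π b c) , class⇒class⁺ a k c (subst (_⊆ alt a k) e h)

  -- Degrees and leading signs

  Headed : Sign → ℕ → Formula L → Set
  Headed plus = E
  Headed minus = U

  -- Headed⁺ plus and Headed⁺ minus are E⁺ and U⁺ definitionally.
  Headed⁺ : Sign → ℕ → Formula L → Set
  Headed⁺ a k φ = Headed a k φ ⊎ ∃[ i ] (i < k × F i φ)

  headed₀ : ∀ a {φ : Formula L} → Headed a 0 φ ⇔ F 0 φ
  headed₀ plus = ⇔-refl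
  headed₀ minus = ⇔-refl

  headed-suc : ∀ a {k} {φ : Formula L} → Headed a (suc k) φ ⇔
    (F (suc k) φ × (∀ s → s ∈ Alt φ → length s ≡ suc k → init s ≡ just a))
  headed-suc plus = ⇔-refl
  headed-suc minus = ⇔-refl

  Alt-alternating : ∀ (φ : Formula L) {s} → s ∈ Alt φ → ∃[ c ] ∃[ j ] (s ≡ alt c j)
  Alt-alternating (rel R ts) (here refl) = plus , 0 , refl
  Alt-alternating bot (here refl) = plus , 0 , refl
  Alt-alternating (φ ⇒ ψ) s∈ with ∈-++⁻ (map _⊥ₚ (Alt φ)) s∈
  ... | inj₂ s∈ψ = Alt-alternating ψ s∈ψ
  ... | inj₁ s∈φ with ∈-map⁻ _⊥ₚ s∈φ
  ...   | _ , s∈′ , refl with Alt-alternating φ s∈′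
  ...     | c , j , refl = swap c , j , alt-⊥ₚ c j
  Alt-alternating (φ ∧ ψ) s∈ with ∈-++⁻ (Alt φ) s∈
  ... | inj₁ s∈φ = Alt-alternating φ s∈φ
  ... | inj₂ s∈ψ = Alt-alternating ψ s∈ψ
  Alt-alternating (φ ∨ ψ) s∈ with ∈-++⁻ (Alt φ) s∈
  ... | inj₁ s∈φ = Alt-alternating φ s∈φ
  ... | inj₂ s∈ψ = Alt-alternating ψ s∈ψ
  Alt-alternating (all x φ) s∈ with ∈-map⁻ addMinus s∈
  ... | _ , s∈′ , refl with Alt-alternating φ s∈′
  ...   | c , j , refl = addSign-alt minus c j
  Alt-alternating (ex x φ) s∈ with ∈-map⁻ addPlus s∈
  ... | _ , s∈′ , refl with Alt-alternating φ s∈′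
  ...   | c , j , refl = addSign-alt plus c j

  alt∈⇒≤deg : ∀ (φ : Formula L) {c j} → alt c j ∈ Alt φ → j ≤ deg φ
  alt∈⇒≤deg φ {c} {j} s∈ = subst (_≤ deg φ) (length-alt c j) (length≤maxLength (Alt φ) s∈)

  deg-attained : ∀ (φ : Formula L) → ∃[ s ] (s ∈ Alt φ × length s ≡ deg φ)
  deg-attained φ with Alt-nonempty φ
  ... | _ , s∈ = maxLength-attained (Alt φ) s∈

  headed⇒within : ∀ a k {φ : Formula L} → Headed a k φ → AltWithin φ (alt a k)
  headed⇒within a zero {φ} h s∈ with Alt-alternating φ s∈
  ... | c , zero , refl = minimum _
  ... | c , suc j , refl with subst (suc j ≤_) (headed₀ a .to h) (alt∈⇒≤deg φ s∈)
  ...   | ()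
  headed⇒within a (suc k) {φ} h s∈ with headed-suc a .to h | Alt-alternating φ s∈
  ... | deg≡ , heads | c , j , refl with m≤n⇒m<n∨m≡n (subst (j ≤_) deg≡ (alt∈⇒≤deg φ s∈))
  ...   | inj₁ j<k = alt-mono-< j<k
  ...   | inj₂ refl with heads _ s∈ (length-alt c (suc k))
  ...     | refl = ⊆-refl

  within⇒headed⁺ : ∀ a k {φ : Formula L} → AltWithin φ (alt a k) → Headed⁺ a k φ
  within⇒headed⁺ a k {φ} w with m≤n⇒m<n∨m≡n (maxLength≤ (Alt φ) (λ s∈ → ⊆-alt⇒length≤ (w s∈)))
  ... | inj₁ deg<k = inj₂ (deg φ , deg<k , refl)
  within⇒headed⁺ a zero w | inj₂ deg≡ = inj₁ (headed₀ a .from deg≡)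
  within⇒headed⁺ a (suc k) w | inj₂ deg≡ =
    inj₁ (headed-suc a .from (deg≡ , λ s s∈ len → cong init (⊆-alt⇒≡ (w s∈) len)))

  headed⁺⇔within : ∀ a k {φ : Formula L} → Headed⁺ a k φ ⇔ AltWithin φ (alt a k)
  headed⁺⇔within a k {φ} = mk⇔ [ headed⇒within a k , lower⇒within ] (within⇒headed⁺ a k)
    where
    lower⇒within : ∃[ i ] (i < k × F i φ) → AltWithin φ (alt a k)
    lower⇒within (i , i<k , refl) s∈ with Alt-alternating φ s∈
    ... | c , j , refl = alt-mono-< (≤-<-trans (alt∈⇒≤deg φ s∈) i<k)

  headed⁺⇔meets : ∀ a k (φ : Formula L) → Headed⁺ a k φ ⇔ PNFMeets φ (Class⁺ a k)
  headed⁺⇔meets a k φ = ⇔-trans (headed⁺⇔within a k) (mk⇔ (within⇒meets a k) (meets⇒within a k))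

  F⁺⇒within : ∀ a {k} (φ : Formula L) → F⁺ k φ → AltWithin φ (alt a (suc k))
  F⁺⇒within a φ d s∈ with Alt-alternating φ s∈
  ... | c , j , refl = alt-mono-< (s≤s (≤-trans (alt∈⇒≤deg φ s∈) d))

  within²⇒F⁺ : ∀ {k} (φ : Formula L) →
    AltWithin φ (alt plus (suc k)) → AltWithin φ (alt minus (suc k)) → F⁺ k φ
  within²⇒F⁺ {k} φ w⁺ w⁻ = maxLength≤ (Alt φ) bound
    where
    bound : ∀ {s} → s ∈ Alt φ → length s ≤ k
    bound s∈ with Alt-alternating φ s∈
    ... | c , j , refl = subst (_≤ k) (sym (length-alt c j)) (alt-⊆-both (λ ()) (w⁺ s∈) (w⁻ s∈))

  F⁺⇔meets : ∀ k (φ : Formula L) →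
    F⁺ k φ ⇔ (PNFMeets φ (SigmaC⁺ (suc k)) × PNFMeets φ (PiC⁺ (suc k)))
  F⁺⇔meets k φ = mk⇔
    (λ d → within⇒meets plus (suc k) (F⁺⇒within plus φ d) ,
           within⇒meets minus (suc k) (F⁺⇒within minus φ d))
    (λ (m⁺ , m⁻) → within²⇒F⁺ φ (meets⇒within plus (suc k) m⁺)
                               (meets⇒within minus (suc k) m⁻))

  headed⇒¬within-swap : ∀ a {k} (φ : Formula L) →
    Headed a (suc k) φ → ¬ AltWithin φ (alt (swap a) (suc k))
  headed⇒¬within-swap a φ h w with headed-suc a .to h | deg-attained φ
  ... | deg≡ , heads | s , s∈ , len =
    ≢-swap a (just-injective (trans (sym (heads s s∈ len′)) (cong init (⊆-alt⇒≡ (w s∈) len′))))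
    where len′ = trans len deg≡

  ¬within-swap⇒headed : ∀ a {k} (φ : Formula L) →
    Headed⁺ a (suc k) φ → ¬ AltWithin φ (alt (swap a) (suc k)) → Headed a (suc k) φ
  ¬within-swap⇒headed a φ (inj₁ h) _ = h
  ¬within-swap⇒headed a φ (inj₂ (_ , s≤s i≤k , refl)) ¬w =
    ⊥-elim (¬w (F⁺⇒within (swap a) φ i≤k))

  PNFMeets-mono : ∀ {C D : Formula L → Set} {φ} → (∀ {ψ} → C ψ → D ψ) → PNFMeets φ C → PNFMeets φ D
  PNFMeets-mono C⇒D (ψ , r , pr , c) = ψ , r , pr , C⇒D c

  PNFMeets-refine : ∀ {C D D′ : Formula L → Set} {φ} → (∀ {ψ} → D ψ → D′ ψ) →
    ¬ PNFMeets φ D′ → PNFMeets φ (λ ψ → C ψ ⊎ D ψ) → PNFMeets φ C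
  PNFMeets-refine _ _ (ψ , r , pr , inj₁ c) = ψ , r , pr , c
  PNFMeets-refine D⇒D′ ¬m (ψ , r , pr , inj₂ d) = ⊥-elim (¬m (ψ , r , pr , D⇒D′ d))

  headed⇔meets : ∀ a k (φ : Formula L) → Headed a (suc k) φ ⇔
    (PNFMeets φ (Class⁺ a (suc k)) × ¬ PNFMeets φ (Class⁺ (swap a) (suc k)))
  headed⇔meets a k φ = mk⇔
    (λ h → headed⁺⇔meets a (suc k) φ .to (inj₁ h) ,
           headed⇒¬within-swap a φ h ∘ meets⇒within (swap a) (suc k))
    (λ (m , ¬m) → ¬within-swap⇒headed a φ (headed⁺⇔meets a (suc k) φ .from m)
                                        (¬m ∘ within⇒meets (swap a) (suc k)))

  headed⇔meets-exact : ∀ a k (φ : Formula L) → Headed a (suc k) φ ⇔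
    (PNFMeets φ (Class a (suc k)) × ¬ PNFMeets φ (Class⁺ (swap a) (suc k)))
  headed⇔meets-exact a k φ = ⇔-trans (headed⇔meets a k φ) (mk⇔
    (λ (m , ¬m) → PNFMeets-refine inj₂ ¬m m , ¬m)
    (λ (m , ¬m) → PNFMeets-mono inj₁ m , ¬m))

  ¬PNFMeets-⊎ : ∀ {C D : Formula L → Set} {φ} →
    ¬ PNFMeets φ C → ¬ PNFMeets φ D → ¬ PNFMeets φ (λ ψ → C ψ ⊎ D ψ)
  ¬PNFMeets-⊎ ¬C _ (ψ , r , pr , inj₁ c) = ¬C (ψ , r , pr , c)
  ¬PNFMeets-⊎ _ ¬D (ψ , r , pr , inj₂ d) = ¬D (ψ , r , pr , d)

  lower-suc⇒low : ∀ {k} {ψ : Formula L} → Lower (suc k) ψ → SigmaC⁺ k ψ ⊎ PiC⁺ k ψ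
  lower-suc⇒low (i , s≤s i≤k , σπ) with m≤n⇒m<n∨m≡n i≤k
  ... | inj₁ i<k = inj₁ (inj₂ (i , i<k , σπ))
  lower-suc⇒low (_ , _ , inj₁ σ) | inj₂ refl = inj₁ (inj₁ σ)
  lower-suc⇒low (_ , _ , inj₂ π) | inj₂ refl = inj₂ (inj₁ π)

  PF⇔F⁺∧¬E⁺∧¬U⁺ : ∀ k (φ : Formula L) → PF k φ ⇔ (F⁺ k φ × ¬ E⁺ k φ × ¬ U⁺ k φ)
  PF⇔F⁺∧¬E⁺∧¬U⁺ k φ = mk⇔
    (λ (deg≡k , ¬EU) →
      ≤-reflexive deg≡k , [ ¬EU ∘ inj₁ , lower deg≡k ] , [ ¬EU ∘ inj₂ , lower deg≡k ])
    (λ (d , ¬E⁺ , ¬U⁺) → exact d ¬E⁺ ¬U⁺)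
    where
    lower : deg φ ≡ k → ¬ (∃[ i ] (i < k × F i φ))
    lower deg≡k (i , i<k , deg≡i) = <-irrefl (trans (sym deg≡i) deg≡k) i<k
    exact : F⁺ k φ → ¬ E⁺ k φ → ¬ U⁺ k φ → PF k φ
    exact d ¬E⁺ ¬U⁺ with m≤n⇒m<n∨m≡n d
    ... | inj₁ deg<k = ⊥-elim (¬E⁺ (inj₂ (deg φ , deg<k , refl)))
    ... | inj₂ deg≡k = deg≡k , [ ¬E⁺ ∘ inj₁ , ¬U⁺ ∘ inj₁ ]

  PF⇔meets : ∀ k (φ : Formula L) → PF k φ ⇔
    (PNFMeets φ (SigmaC⁺ (suc k)) × PNFMeets φ (PiC⁺ (suc k))
      × ¬ PNFMeets φ (λ ψ → SigmaC⁺ k ψ ⊎ PiC⁺ k ψ))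
  PF⇔meets k φ = ⇔-trans (PF⇔F⁺∧¬E⁺∧¬U⁺ k φ) (mk⇔
    (λ (d , ¬E⁺ , ¬U⁺) →
      F⁺⇔meets k φ .to d .proj₁ , F⁺⇔meets k φ .to d .proj₂ ,
      ¬PNFMeets-⊎ (¬E⁺ ∘ headed⁺⇔meets plus k φ .from) (¬U⁺ ∘ headed⁺⇔meets minus k φ .from))
    (λ (m⁺ , m⁻ , ¬m) →
      F⁺⇔meets k φ .from (m⁺ , m⁻) ,
      ¬m ∘ PNFMeets-mono inj₁ ∘ headed⁺⇔meets plus k φ .to ,
      ¬m ∘ PNFMeets-mono inj₂ ∘ headed⁺⇔meets minus k φ .to))

  PF⇔meets-exact : ∀ k (φ : Formula L) → PF k φ ⇔
    (PNFMeets φ (SigmaC (suc k)) × PNFMeets φ (PiC (suc k))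
      × ¬ PNFMeets φ (λ ψ → SigmaC⁺ k ψ ⊎ PiC⁺ k ψ))
  PF⇔meets-exact k φ = ⇔-trans (PF⇔meets k φ) (mk⇔
    (λ (m⁺ , m⁻ , ¬m) →
      PNFMeets-refine lower-suc⇒low ¬m m⁺ , PNFMeets-refine lower-suc⇒low ¬m m⁻ , ¬m)
    (λ (m⁺ , m⁻ , ¬m) → PNFMeets-mono inj₁ m⁺ , PNFMeets-mono inj₁ m⁻ , ¬m))

theorem4p8 : {L : Signature} (k : ℕ) (φ : Formula L) →
    (E⁺ k φ ⇔ PNFMeets φ (SigmaC⁺ k))
  × (U⁺ k φ ⇔ PNFMeets φ (PiC⁺ k))
  × (F⁺ k φ ⇔ (PNFMeets φ (SigmaC⁺ (suc k)) × PNFMeets φ (PiC⁺ (suc k))))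
  × ((E (suc k) φ ⇔ (PNFMeets φ (SigmaC⁺ (suc k)) × ¬ PNFMeets φ (PiC⁺ (suc k))))
    × (E (suc k) φ ⇔ (PNFMeets φ (SigmaC (suc k)) × ¬ PNFMeets φ (PiC⁺ (suc k)))))
  × ((U (suc k) φ ⇔ (PNFMeets φ (PiC⁺ (suc k)) × ¬ PNFMeets φ (SigmaC⁺ (suc k))))
    × (U (suc k) φ ⇔ (PNFMeets φ (PiC (suc k)) × ¬ PNFMeets φ (SigmaC⁺ (suc k)))))
  × ((PF k φ ⇔ (PNFMeets φ (SigmaC⁺ (suc k)) × PNFMeets φ (PiC⁺ (suc k))
                × ¬ PNFMeets φ (λ ψ → SigmaC⁺ k ψ ⊎ PiC⁺ k ψ)))
    × (PF k φ ⇔ (PNFMeets φ (SigmaC (suc k)) × PNFMeets φ (PiC (suc k))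
                × ¬ PNFMeets φ (λ ψ → SigmaC⁺ k ψ ⊎ PiC⁺ k ψ))))
theorem4p8 k φ =
  headed⁺⇔meets plus k φ ,
  headed⁺⇔meets minus k φ ,
  F⁺⇔meets k φ ,
  (headed⇔meets plus k φ , headed⇔meets-exact plus k φ) ,
  (headed⇔meets minus k φ , headed⇔meets-exact minus k φ) ,
  (PF⇔meets k φ , PF⇔meets-exact k φ)
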